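{- Let $r\ge 1$ be an integer and suppose that $A\subseteq\mathbb{F}_2^r$ satisfies $|A|>2^{r-2}+3$. If $(a_1,a_2)$ is an edge of $\Gamma(A)$, then $$\deg(a_1)+\deg(a_2)\ge |A|+|D(A)|-2^{r-1},$$ where $\deg$ denotes the degree in $\Gamma(A)$.
   Context: $\mathbb{F}_2^r$ denotes the elementary abelian $2$-group of rank $r$. For $A\subseteq\mathbb{F}_2^r$, $D(A)$ is the set of elements of $\mathbb{F}_2^r$ having exactly one representation, up to the order of summands, as $a_1+a_2$ with $a_1,a_2\in A$. The unique representation graph $\Gamma(A)$ is the graph with vertex set $A$ in which distinct $a_1,a_2\in A$ are adjacent iff $a_1+a_2\in D(A)$. -}

module Defs where

open import Data.Bool using (Bool; true; false; _xor_)
open import Data.Bool.Properties using () renaming (_≟_ to _≟B_)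
open import Data.Nat using (ℕ; zero; suc)
open import Data.Nat.Properties using () renaming (_≟_ to _≟ℕ_)
open import Data.Vec using (Vec; []; _∷_; zipWith)
open import Data.Vec.Properties using (≡-dec)
open import Data.List using (List; []; _∷_; _++_; map; filter; length)
open import Data.Product using (_×_; _,_)
open import Relation.Nullary using (Dec; ¬_)
open import Relation.Nullary.Decidable using (_×-dec_; ¬?)
open import Relation.Binary.PropositionalEquality using (_≡_)

F2^ : ℕ → Set
F2^ r = Vec Bool r

_⊕_ : ∀ {r} → F2^ r → F2^ r → F2^ r
_⊕_ = zipWith _xor_

_≟V_ : ∀ {r} (x y : F2^ r) → Dec (x ≡ y)
_≟V_ = ≡-dec _≟B_

allVecs : (r : ℕ) → List (F2^ r)
allVecs zero = [] ∷ []
allVecs (suc r) = map (true ∷_) (allVecs r) ++ map (false ∷_) (allVecs r)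

-- Unordered pairs {a,b} (a = b allowed) of elements of a duplicate-free list,
-- each listed exactly once.
upairs : ∀ {A : Set} → List A → List (A × A)
upairs [] = []
upairs (a ∷ as) = map (a ,_) (a ∷ as) ++ upairs as

reps : ∀ {r} → List (F2^ r) → F2^ r → ℕ
reps A x = length (filter (λ p → (Data.Product.proj₁ p ⊕ Data.Product.proj₂ p) ≟V x) (upairs A))

InD : ∀ {r} → List (F2^ r) → F2^ r → Set
InD A x = reps A x ≡ 1

InD? : ∀ {r} (A : List (F2^ r)) (x : F2^ r) → Dec (InD A x)
InD? A x = reps A x ≟ℕ 1

D : ∀ {r} → List (F2^ r) → List (F2^ r)
D {r} A = filter (InD? A) (allVecs r)

-- Adjacency in the unique representation graph Γ(A) (for vertices a, b ∈ A).
Adj : ∀ {r} → List (F2^ r) → F2^ r → F2^ r → Set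
Adj A a b = (¬ a ≡ b) × InD A (a ⊕ b)

Adj? : ∀ {r} (A : List (F2^ r)) (a b : F2^ r) → Dec (Adj A a b)
Adj? A a b = ¬? (a ≟V b) ×-dec InD? A (a ⊕ b)

deg : ∀ {r} → List (F2^ r) → F2^ r → ℕ
deg A a = length (filter (Adj? A a) A)

module Submission where

-- Let A ⊆ F₂^r be a duplicate-free list with 4|A| > 2^r + 12 and let a₁a₂ be an
-- edge of Γ(A), so s = a₁ ⊕ a₂ ∈ D(A). Write α, δ for the indicator functions of
-- A and D(A). We double count the function
--     F(v) = α(v) + δ(a₁ ⊕ v)      (total |A| + |D(A)|)
-- against
--     G(v) = α(v)·([a₁ ~ v] + [a₂ ~ v])      (total deg a₁ + deg a₂)
-- over the pairs {v, v ⊕ s}: on every such pair F(v) + F(v ⊕ s) ≤ G(v) + G(v ⊕ s) + 1,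
-- and summing over all v gives 2(|A| + |D(A)|) ≤ 2(deg a₁ + deg a₂) + 2^r.
-- The pair inequality rests on two structural facts:
--   * no D-triangle: if x, y and x ⊕ y all lie in D(A) then 4|A| ≤ 2^r + 12
--     (count A on the cosets of {0, x, y, x ⊕ y}: four points span six pairs);
--   * unique partner: {a₁, a₂} is the only pair of A with difference s.

open import Defs
open import Data.Bool using (true; false; _xor_)
open import Data.Bool.Properties using (xor-comm; xor-assoc; xor-same)
open import Data.Nat using (ℕ; zero; suc; _+_; _*_; _∸_; _^_; _≤_; _<_; z≤n; s≤s)
open import Data.Nat.Properties
open import Data.Nat.Tactic.RingSolver using (solve-∀)
open import Algebra.Properties.CommutativeSemigroup +-commutativeSemigroup using (interchange)
open import Data.Vec using ([]; _∷_; replicate; head; tail)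
open import Data.Vec.Properties using (zipWith-comm; zipWith-assoc; zipWith-identityˡ)
open import Data.List using (List; []; _∷_; _++_; map; filter; length)
open import Data.List.Membership.Propositional using (_∈_)
open import Data.List.Relation.Unary.Any using (here; there)
open import Data.List.Relation.Unary.All using (All; []; _∷_)
open import Data.List.Relation.Unary.AllPairs using ([]; _∷_)
open import Data.List.Relation.Unary.Unique.Propositional using (Unique)
open import Data.Product using (_×_; _,_; proj₁; proj₂)
open import Data.Sum using (inj₁; inj₂)
open import Data.Empty using (⊥; ⊥-elim)
open import Relation.Nullary using (Dec; yes; no; ¬_)
open import Relation.Unary using (Pred; Decidable)
open import Relation.Binary.PropositionalEquality

ind : ∀ {p} {P : Set p} → Dec P → ℕ
ind (yes _) = 1
ind (no _)  = 0

ind-yes : ∀ {p} {P : Set p} (d : Dec P) → P → ind d ≡ 1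
ind-yes (yes _) _ = refl
ind-yes (no ¬p) p = ⊥-elim (¬p p)

ind-no : ∀ {p} {P : Set p} (d : Dec P) → ¬ P → ind d ≡ 0
ind-no (yes p) ¬p = ⊥-elim (¬p p)
ind-no (no _)  _  = refl

ind≤1 : ∀ {p} {P : Set p} (d : Dec P) → ind d ≤ 1
ind≤1 (yes _) = s≤s z≤n
ind≤1 (no _)  = z≤n

ind-iff : ∀ {p q} {P : Set p} {Q : Set q} (d : Dec P) (e : Dec Q) →
          (P → Q) → (Q → P) → ind d ≡ ind e
ind-iff (yes p) e f _ = sym (ind-yes e (f p))
ind-iff (no ¬p) e _ g = sym (ind-no e (λ q → ¬p (g q)))

ind-exclusive : ∀ {p q} {P : Set p} {Q : Set q} (d : Dec P) (e : Dec Q) →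
                (P → Q → ⊥) → ind d + ind e ≤ 1
ind-exclusive (yes p) (yes q) excl = ⊥-elim (excl p q)
ind-exclusive (yes _) (no _)  excl = s≤s z≤n
ind-exclusive (no _)  e       excl = ind≤1 e

private
  variable
    X Y : Set

∑ : List X → (X → ℕ) → ℕ
∑ []       f = 0
∑ (x ∷ xs) f = f x + ∑ xs f


∑-++ : (L M : List X) (f : X → ℕ) → ∑ (L ++ M) f ≡ ∑ L f + ∑ M f
∑-++ []      M f = refl
∑-++ (x ∷ L) M f = trans (cong (f x +_) (∑-++ L M f)) (sym (+-assoc (f x) _ _))

∑-map : (g : X → Y) (L : List X) (f : Y → ℕ) → ∑ (map g L) f ≡ ∑ L (λ x → f (g x))
∑-map g []      f = refl
∑-map g (x ∷ L) f = cong (f (g x) +_) (∑-map g L f)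

∑-cong : (L : List X) {f g : X → ℕ} → (∀ x → f x ≡ g x) → ∑ L f ≡ ∑ L g
∑-cong []      eq = refl
∑-cong (x ∷ L) eq = cong₂ _+_ (eq x) (∑-cong L eq)

∑-mono : (L : List X) {f g : X → ℕ} → (∀ x → f x ≤ g x) → ∑ L f ≤ ∑ L g
∑-mono []      le = z≤n
∑-mono (x ∷ L) le = +-mono-≤ (le x) (∑-mono L le)

∑-+ : (L : List X) (f g : X → ℕ) → ∑ L (λ x → f x + g x) ≡ ∑ L f + ∑ L g
∑-+ []      f g = refl
∑-+ (x ∷ L) f g = trans (cong (f x + g x +_) (∑-+ L f g)) (interchange (f x) (g x) (∑ L f) (∑ L g))

∑-zero : (L : List X) → ∑ L (λ _ → 0) ≡ 0
∑-zero []      = refl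
∑-zero (x ∷ L) = ∑-zero L

∑-one : (L : List X) → ∑ L (λ _ → 1) ≡ length L
∑-one []      = refl
∑-one (x ∷ L) = cong suc (∑-one L)

length-filter : ∀ {p} {P : Pred X p} (P? : Decidable P) (L : List X) →
                length (filter P? L) ≡ ∑ L (λ x → ind (P? x))
length-filter P? []      = refl
length-filter P? (x ∷ L) with P? x
... | yes _ = cong suc (length-filter P? L)
... | no _  = length-filter P? L

∑-upairs-∷ : (a : X) (L : List X) (h : X × X → ℕ) →
             ∑ (upairs (a ∷ L)) h ≡ h (a , a) + ∑ L (λ w → h (a , w)) + ∑ (upairs L) h
∑-upairs-∷ a L h = begin
    ∑ (map (a ,_) (a ∷ L) ++ upairs L) h
  ≡⟨ ∑-++ (map (a ,_) (a ∷ L)) (upairs L) h ⟩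
    h (a , a) + ∑ (map (a ,_) L) h + ∑ (upairs L) h
  ≡⟨ cong (λ t → h (a , a) + t + ∑ (upairs L) h) (∑-map (a ,_) L h) ⟩
    h (a , a) + ∑ L (λ w → h (a , w)) + ∑ (upairs L) h
  ∎
  where open ≡-Reasoning

upairs-diagonal : (L : List X) (h : X × X → ℕ) → ∑ L (λ a → h (a , a)) ≤ ∑ (upairs L) h
upairs-diagonal []      h = z≤n
upairs-diagonal (a ∷ L) h = begin
    h (a , a) + ∑ L (λ a → h (a , a))
  ≤⟨ +-monoʳ-≤ (h (a , a)) (upairs-diagonal L h) ⟩
    h (a , a) + ∑ (upairs L) h
  ≤⟨ +-monoˡ-≤ (∑ (upairs L) h) (m≤m+n (h (a , a)) _) ⟩
    h (a , a) + ∑ L (λ w → h (a , w)) + ∑ (upairs L) h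
  ≡⟨ sym (∑-upairs-∷ a L h) ⟩
    ∑ (upairs (a ∷ L)) h
  ∎
  where open ≤-Reasoning

-- A symmetric function summed over all ordered pairs is at most twice its
-- sum over unordered pairs (each off-diagonal pair is counted twice).
upairs-ordered : (L : List X) (h : X × X → ℕ) → (∀ u w → h (u , w) ≡ h (w , u)) →
                 ∑ L (λ u → ∑ L (λ w → h (u , w))) ≤ 2 * ∑ (upairs L) h
upairs-ordered []      h symm = z≤n
upairs-ordered (a ∷ L) h symm = begin
    h₀ + row + ∑ L (λ u → h (u , a) + ∑ L (λ w → h (u , w)))
  ≡⟨ cong (h₀ + row +_) (∑-+ L (λ u → h (u , a)) (λ u → ∑ L (λ w → h (u , w)))) ⟩
    h₀ + row + (∑ L (λ u → h (u , a)) + ∑ L (λ u → ∑ L (λ w → h (u , w))))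
  ≡⟨ cong (λ t → h₀ + row + (t + _)) (∑-cong L (λ u → symm u a)) ⟩
    h₀ + row + (row + ∑ L (λ u → ∑ L (λ w → h (u , w))))
  ≤⟨ +-monoʳ-≤ (h₀ + row) (+-monoʳ-≤ row (upairs-ordered L h symm)) ⟩
    h₀ + row + (row + 2 * rest)
  ≤⟨ m≤n+m _ h₀ ⟩
    h₀ + (h₀ + row + (row + 2 * rest))
  ≡⟨ regroup h₀ row rest ⟩
    2 * (h₀ + row + rest)
  ≡⟨ cong (2 *_) (sym (∑-upairs-∷ a L h)) ⟩
    2 * ∑ (upairs (a ∷ L)) h
  ∎
  where
  open ≤-Reasoning
  h₀ = h (a , a)
  row = ∑ L (λ w → h (a , w))
  rest = ∑ (upairs L) h
  regroup : ∀ p q n → p + (p + q + (q + 2 * n)) ≡ 2 * (p + q + n)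
  regroup = solve-∀

𝟎 : ∀ {r} → F2^ r
𝟎 {r} = replicate r false

⊕-self : ∀ {r} (x : F2^ r) → x ⊕ x ≡ 𝟎
⊕-self []      = refl
⊕-self (b ∷ x) = cong₂ _∷_ (xor-same b) (⊕-self x)

module _ {r : ℕ} where

  ⊕-comm : (x y : F2^ r) → x ⊕ y ≡ y ⊕ x
  ⊕-comm = zipWith-comm xor-comm

  ⊕-assoc : (x y z : F2^ r) → (x ⊕ y) ⊕ z ≡ x ⊕ (y ⊕ z)
  ⊕-assoc = zipWith-assoc xor-assoc

  ⊕-identityˡ : (x : F2^ r) → 𝟎 ⊕ x ≡ x
  ⊕-identityˡ = zipWith-identityˡ (λ _ → refl)

  ⊕-cancelˡ : (x y : F2^ r) → x ⊕ (x ⊕ y) ≡ y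
  ⊕-cancelˡ x y = begin
      x ⊕ (x ⊕ y)  ≡⟨ sym (⊕-assoc x x y) ⟩
      (x ⊕ x) ⊕ y  ≡⟨ cong (_⊕ y) (⊕-self x) ⟩
      𝟎 ⊕ y        ≡⟨ ⊕-identityˡ y ⟩
      y            ∎
    where open ≡-Reasoning

  ⊕-cancelʳ : (x y : F2^ r) → (y ⊕ x) ⊕ x ≡ y
  ⊕-cancelʳ x y = trans (⊕-comm (y ⊕ x) x) (trans (cong (x ⊕_) (⊕-comm y x)) (⊕-cancelˡ x y))

  ⊕-cancelᵐ : (x y : F2^ r) → y ⊕ (x ⊕ y) ≡ x
  ⊕-cancelᵐ x y = trans (cong (y ⊕_) (⊕-comm x y)) (⊕-cancelˡ y x)

  ⊕-move : (x v s : F2^ r) → x ≡ v ⊕ s → v ≡ x ⊕ s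
  ⊕-move x v s eq = trans (sym (⊕-cancelʳ s v)) (cong (_⊕ s) (sym eq))

  ⊕-shift : (a b v : F2^ r) → a ⊕ (v ⊕ (a ⊕ b)) ≡ b ⊕ v
  ⊕-shift a b v = begin
      a ⊕ (v ⊕ (a ⊕ b))  ≡⟨ cong (a ⊕_) (⊕-comm v (a ⊕ b)) ⟩
      a ⊕ ((a ⊕ b) ⊕ v)  ≡⟨ sym (⊕-assoc a (a ⊕ b) v) ⟩
      (a ⊕ (a ⊕ b)) ⊕ v  ≡⟨ cong (_⊕ v) (⊕-cancelˡ a b) ⟩
      b ⊕ v              ∎
    where open ≡-Reasoning

  ⊕-cancel-common : (a b c : F2^ r) → (a ⊕ c) ⊕ (b ⊕ c) ≡ a ⊕ b
  ⊕-cancel-common a b c = begin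
      (a ⊕ c) ⊕ (b ⊕ c)  ≡⟨ ⊕-assoc a c (b ⊕ c) ⟩
      a ⊕ (c ⊕ (b ⊕ c))  ≡⟨ cong (λ t → a ⊕ (c ⊕ t)) (⊕-comm b c) ⟩
      a ⊕ (c ⊕ (c ⊕ b))  ≡⟨ cong (a ⊕_) (⊕-cancelˡ c b) ⟩
      a ⊕ b              ∎
    where open ≡-Reasoning

∑V : (r : ℕ) → (F2^ r → ℕ) → ℕ
∑V r = ∑ (allVecs r)

∑V-split : ∀ r (f : F2^ (suc r) → ℕ) →
           ∑V (suc r) f ≡ ∑V r (λ w → f (true ∷ w)) + ∑V r (λ w → f (false ∷ w))
∑V-split r f = trans (∑-++ (map (true ∷_) (allVecs r)) _ f)
                     (cong₂ _+_ (∑-map (true ∷_) (allVecs r) f) (∑-map (false ∷_) (allVecs r) f))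

∑V-one : ∀ r → ∑V r (λ _ → 1) ≡ 2 ^ r
∑V-one zero    = refl
∑V-one (suc r) = trans (∑V-split r (λ _ → 1))
                       (trans (cong₂ _+_ (∑V-one r) (∑V-one r)) (cong (2 ^ r +_) (sym (+-identityʳ _))))

∑V-translate : ∀ r (f : F2^ r → ℕ) (t : F2^ r) → ∑V r (λ v → f (v ⊕ t)) ≡ ∑V r f
∑V-translate zero    f []      = refl
∑V-translate (suc r) f (b ∷ t) = begin
    ∑V (suc r) (λ v → f (v ⊕ (b ∷ t)))
  ≡⟨ ∑V-split r _ ⟩
    ∑V r (λ w → f ((true xor b) ∷ (w ⊕ t))) + ∑V r (λ w → f ((false xor b) ∷ (w ⊕ t)))
  ≡⟨ cong₂ _+_ (∑V-translate r _ t) (∑V-translate r _ t) ⟩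
    ∑V r (λ w → f ((true xor b) ∷ w)) + ∑V r (λ w → f ((false xor b) ∷ w))
  ≡⟨ halves b ⟩
    ∑V r (λ w → f (true ∷ w)) + ∑V r (λ w → f (false ∷ w))
  ≡⟨ sym (∑V-split r f) ⟩
    ∑V (suc r) f
  ∎
  where
  open ≡-Reasoning
  -- translating by b ∷ t with b = true swaps the two halves
  halves : ∀ b → ∑V r (λ w → f ((true xor b) ∷ w)) + ∑V r (λ w → f ((false xor b) ∷ w))
               ≡ ∑V r (λ w → f (true ∷ w)) + ∑V r (λ w → f (false ∷ w))
  halves true  = +-comm (∑V r (λ w → f (false ∷ w))) (∑V r (λ w → f (true ∷ w)))
  halves false = refl

∑V-doubled : ∀ r (f : F2^ r → ℕ) (t : F2^ r) → 2 * ∑V r f ≡ ∑V r (λ v → f v + f (v ⊕ t))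
∑V-doubled r f t = begin
    2 * ∑V r f
  ≡⟨ cong (∑V r f +_) (+-identityʳ _) ⟩
    ∑V r f + ∑V r f
  ≡⟨ cong (∑V r f +_) (sym (∑V-translate r f t)) ⟩
    ∑V r f + ∑V r (λ v → f (v ⊕ t))
  ≡⟨ sym (∑-+ (allVecs r) f _) ⟩
    ∑V r (λ v → f v + f (v ⊕ t))
  ∎
  where open ≡-Reasoning

∑V-point : ∀ r (c : F2^ r) (h : F2^ r → ℕ) → ∑V r (λ w → ind (c ≟V w) * h w) ≡ h c
∑V-point zero    []      h = trans (+-identityʳ _) (*-identityˡ _)
∑V-point (suc r) (b ∷ c) h = trans (∑V-split r _) (halves b)
  where
  on-c : ∀ b → ∑V r (λ w → ind ((b ∷ c) ≟V (b ∷ w)) * h (b ∷ w)) ≡ h (b ∷ c)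
  on-c b = trans (∑-cong (allVecs r) (λ w → cong (_* h (b ∷ w))
                   (ind-iff ((b ∷ c) ≟V (b ∷ w)) (c ≟V w) (cong tail) (cong (b ∷_)))))
                 (∑V-point r c (λ w → h (b ∷ w)))
  off-c : ∀ b b′ → ¬ b ≡ b′ → ∑V r (λ w → ind ((b ∷ c) ≟V (b′ ∷ w)) * h (b′ ∷ w)) ≡ 0
  off-c b b′ b≢b′ = trans (∑-cong (allVecs r) (λ w → cong (_* h (b′ ∷ w))
                      (ind-no ((b ∷ c) ≟V (b′ ∷ w)) (λ eq → b≢b′ (cong head eq)))))
                    (∑-zero (allVecs r))
  halves : ∀ b → ∑V r (λ w → ind ((b ∷ c) ≟V (true ∷ w)) * h (true ∷ w))
               + ∑V r (λ w → ind ((b ∷ c) ≟V (false ∷ w)) * h (false ∷ w)) ≡ h (b ∷ c)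
  halves true  = trans (cong₂ _+_ (on-c true) (off-c true false (λ ()))) (+-identityʳ _)
  halves false = cong₂ _+_ (off-c false true (λ ())) (on-c false)

-- The multiplicity of v in a list; for a duplicate-free list it is the
-- indicator function of the underlying set.
mult : ∀ {r} → List (F2^ r) → F2^ r → ℕ
mult A v = ∑ A (λ w → ind (w ≟V v))

module _ {r : ℕ} where

  ∑V-mult : (A : List (F2^ r)) (h : F2^ r → ℕ) → ∑V r (λ v → mult A v * h v) ≡ ∑ A h
  ∑V-mult []      h = ∑-zero (allVecs r)
  ∑V-mult (a ∷ A) h = begin
      ∑V r (λ v → (ind (a ≟V v) + mult A v) * h v)
    ≡⟨ ∑-cong (allVecs r) (λ v → *-distribʳ-+ (h v) (ind (a ≟V v)) (mult A v)) ⟩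
      ∑V r (λ v → ind (a ≟V v) * h v + mult A v * h v)
    ≡⟨ ∑-+ (allVecs r) _ _ ⟩
      ∑V r (λ v → ind (a ≟V v) * h v) + ∑V r (λ v → mult A v * h v)
    ≡⟨ cong₂ _+_ (∑V-point r a h) (∑V-mult A h) ⟩
      h a + ∑ A h
    ∎
    where open ≡-Reasoning

  mult-∉ : (A : List (F2^ r)) (v : F2^ r) → All (λ w → ¬ v ≡ w) A → mult A v ≡ 0
  mult-∉ []      v []         = refl
  mult-∉ (w ∷ A) v (v≢w ∷ ps) = cong₂ _+_ (ind-no (w ≟V v) (λ eq → v≢w (sym eq))) (mult-∉ A v ps)

  mult≤1 : (A : List (F2^ r)) → Unique A → ∀ v → mult A v ≤ 1
  mult≤1 []      []         v = z≤n
  mult≤1 (w ∷ A) (ps ∷ uA)  v with w ≟V v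
  ... | yes refl = ≤-reflexive (cong suc (mult-∉ A w ps))
  ... | no _     = mult≤1 A uA v

  mult-∈ : (A : List (F2^ r)) (v : F2^ r) → v ∈ A → 1 ≤ mult A v
  mult-∈ (w ∷ A) v (here refl) = ≤-trans (≤-reflexive (sym (ind-yes (w ≟V w) refl))) (m≤m+n _ _)
  mult-∈ (w ∷ A) v (there p)   = ≤-trans (mult-∈ A v p) (m≤n+m _ _)

  ∑-unique≤∑V : (L : List (F2^ r)) → Unique L → (f : F2^ r → ℕ) → ∑ L f ≤ ∑V r f
  ∑-unique≤∑V L uL f = begin
      ∑ L f                          ≡⟨ sym (∑V-mult L f) ⟩
      ∑V r (λ v → mult L v * f v)    ≤⟨ ∑-mono (allVecs r) (λ v → *-monoˡ-≤ (f v) (mult≤1 L uL v)) ⟩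
      ∑V r (λ v → 1 * f v)           ≡⟨ ∑-cong (allVecs r) (λ v → *-identityˡ (f v)) ⟩
      ∑V r f                         ∎
    where open ≤-Reasoning

  -- The ordered representation count of t: the number of (u, w) ∈ A² with u ⊕ w = t.
  R : List (F2^ r) → F2^ r → ℕ
  R A t = ∑V r (λ v → mult A v * mult A (v ⊕ t))

  R≤2reps : (A : List (F2^ r)) (t : F2^ r) → R A t ≤ 2 * reps A t
  R≤2reps A t = begin
      R A t
    ≡⟨ ∑V-mult A (λ v → mult A (v ⊕ t)) ⟩
      ∑ A (λ u → ∑ A (λ w → ind (w ≟V (u ⊕ t))))
    ≡⟨ ∑-cong A (λ u → ∑-cong A (λ w → ind-iff (w ≟V (u ⊕ t)) ((u ⊕ w) ≟V t)
          (λ eq → trans (cong (u ⊕_) eq) (⊕-cancelˡ u t))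
          (λ eq → trans (sym (⊕-cancelˡ u w)) (cong (u ⊕_) eq)))) ⟩
      ∑ A (λ u → ∑ A (λ w → sumsTo (u , w)))
    ≤⟨ upairs-ordered A sumsTo (λ u w → ind-iff ((u ⊕ w) ≟V t) ((w ⊕ u) ≟V t)
          (trans (⊕-comm w u)) (trans (⊕-comm u w))) ⟩
      2 * ∑ (upairs A) sumsTo
    ≡⟨ cong (2 *_) (sym (length-filter (λ p → (proj₁ p ⊕ proj₂ p) ≟V t) (upairs A))) ⟩
      2 * reps A t
    ∎
    where
    open ≤-Reasoning
    sumsTo : F2^ r × F2^ r → ℕ
    sumsTo p = ind ((proj₁ p ⊕ proj₂ p) ≟V t)

  -- 𝟎 = a ⊕ a is represented by every a ∈ A.
  length≤reps𝟎 : (A : List (F2^ r)) → length A ≤ reps A 𝟎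
  length≤reps𝟎 A = begin
      length A
    ≡⟨ sym (∑-one A) ⟩
      ∑ A (λ _ → 1)
    ≡⟨ ∑-cong A (λ a → sym (ind-yes ((a ⊕ a) ≟V 𝟎) (⊕-self a))) ⟩
      ∑ A (λ a → ind ((a ⊕ a) ≟V 𝟎))
    ≤⟨ upairs-diagonal A (λ p → ind ((proj₁ p ⊕ proj₂ p) ≟V 𝟎)) ⟩
      ∑ (upairs A) (λ p → ind ((proj₁ p ⊕ proj₂ p) ≟V 𝟎))
    ≡⟨ sym (length-filter (λ p → (proj₁ p ⊕ proj₂ p) ≟V 𝟎) (upairs A)) ⟩
      reps A 𝟎
    ∎
    where open ≤-Reasoning

  R-translate : (A : List (F2^ r)) (c d : F2^ r) →
                ∑V r (λ v → mult A (v ⊕ c) * mult A (v ⊕ d)) ≡ R A (c ⊕ d)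
  R-translate A c d = trans (sym (∑V-translate r _ c))
    (∑-cong (allVecs r) (λ v → cong₂ (λ x y → mult A x * mult A y) (⊕-cancelʳ c v) (⊕-assoc v c d)))

bits-sum≤1 : ∀ {a b} → a ≤ 1 → b ≤ 1 → a * b ≡ 0 → a + b ≤ 1
bits-sum≤1 {a} {b} a≤1 b≤1 ab≡0 with m*n≡0⇒m≡0∨n≡0 a ab≡0
... | inj₁ refl = b≤1
... | inj₂ refl = ≤-trans (≤-reflexive (+-identityʳ a)) a≤1

bit-+≤*+1 : ∀ {u t} → u ≤ 1 → t ≤ 1 → u + t ≤ u * t + 1
bit-+≤*+1 z≤n       t≤1 = ≤-trans t≤1 (≤-reflexive refl)
bit-+≤*+1 {t = t} (s≤s z≤n) t≤1 = ≤-reflexive (trans (+-comm 1 t) (cong (_+ 1) (sym (+-identityʳ t))))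

-- Four points of which k are present span at least k - 1 pairs; the six
-- pairs are grouped by their difference in a subgroup {0, x, y, x ⊕ y}.
four-points : ∀ {a b c d} → a ≤ 1 → b ≤ 1 → c ≤ 1 → d ≤ 1 →
              a + b + c + d ≤ 1 + ((a * b + c * d) + (a * c + b * d)) + (a * d + b * c)
four-points z≤n       z≤n       z≤n       z≤n       = ≤ᵇ⇒≤ _ _ _
four-points z≤n       z≤n       z≤n       (s≤s z≤n) = ≤ᵇ⇒≤ _ _ _
four-points z≤n       z≤n       (s≤s z≤n) z≤n       = ≤ᵇ⇒≤ _ _ _
four-points z≤n       z≤n       (s≤s z≤n) (s≤s z≤n) = ≤ᵇ⇒≤ _ _ _
four-points z≤n       (s≤s z≤n) z≤n       z≤n       = ≤ᵇ⇒≤ _ _ _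
four-points z≤n       (s≤s z≤n) z≤n       (s≤s z≤n) = ≤ᵇ⇒≤ _ _ _
four-points z≤n       (s≤s z≤n) (s≤s z≤n) z≤n       = ≤ᵇ⇒≤ _ _ _
four-points z≤n       (s≤s z≤n) (s≤s z≤n) (s≤s z≤n) = ≤ᵇ⇒≤ _ _ _
four-points (s≤s z≤n) z≤n       z≤n       z≤n       = ≤ᵇ⇒≤ _ _ _
four-points (s≤s z≤n) z≤n       z≤n       (s≤s z≤n) = ≤ᵇ⇒≤ _ _ _
four-points (s≤s z≤n) z≤n       (s≤s z≤n) z≤n       = ≤ᵇ⇒≤ _ _ _
four-points (s≤s z≤n) z≤n       (s≤s z≤n) (s≤s z≤n) = ≤ᵇ⇒≤ _ _ _
four-points (s≤s z≤n) (s≤s z≤n) z≤n       z≤n       = ≤ᵇ⇒≤ _ _ _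
four-points (s≤s z≤n) (s≤s z≤n) z≤n       (s≤s z≤n) = ≤ᵇ⇒≤ _ _ _
four-points (s≤s z≤n) (s≤s z≤n) (s≤s z≤n) z≤n       = ≤ᵇ⇒≤ _ _ _
four-points (s≤s z≤n) (s≤s z≤n) (s≤s z≤n) (s≤s z≤n) = ≤ᵇ⇒≤ _ _ _

module Indicators {r : ℕ} (A : List (F2^ r)) (uA : Unique A) where

  α : F2^ r → ℕ
  α = mult A

  δ : F2^ r → ℕ
  δ t = ind (InD? A t)

  α≤1 : ∀ v → α v ≤ 1
  α≤1 = mult≤1 A uA

  α-∈ : ∀ {v} → v ∈ A → α v ≡ 1
  α-∈ {v} v∈A = ≤-antisym (α≤1 v) (mult-∈ A v v∈A)

  ∑α : ∑V r α ≡ length A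
  ∑α = begin
      ∑V r α                   ≡⟨ ∑-cong (allVecs r) (λ v → sym (*-identityʳ (α v))) ⟩
      ∑V r (λ v → α v * 1)     ≡⟨ ∑V-mult A (λ _ → 1) ⟩
      ∑ A (λ _ → 1)            ≡⟨ ∑-one A ⟩
      length A                 ∎
    where open ≡-Reasoning

  ∑α-translate : ∀ c → ∑V r (λ v → α (v ⊕ c)) ≡ length A
  ∑α-translate c = trans (∑V-translate r α c) ∑α

  ∑δ-translate : ∀ c → ∑V r (λ v → δ (c ⊕ v)) ≡ length (D A)
  ∑δ-translate c = begin
      ∑V r (λ v → δ (c ⊕ v))   ≡⟨ ∑-cong (allVecs r) (λ v → cong δ (⊕-comm c v)) ⟩
      ∑V r (λ v → δ (v ⊕ c))   ≡⟨ ∑V-translate r δ c ⟩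
      ∑V r δ                   ≡⟨ sym (length-filter (InD? A) (allVecs r)) ⟩
      length (D A)             ∎
    where open ≡-Reasoning

  ∑deg : ∀ a → ∑V r (λ v → α v * ind (Adj? A a v)) ≡ deg A a
  ∑deg a = trans (∑V-mult A (λ v → ind (Adj? A a v))) (sym (length-filter (Adj? A a) A))

  R≤2 : ∀ {t} → InD A t → R A t ≤ 2
  R≤2 {t} t∈D = ≤-trans (R≤2reps A t) (≤-reflexive (cong (2 *_) t∈D))

  -- Once |A| ≥ 2, the element 𝟎 = a ⊕ a has several representations.
  δ-self : 2 ≤ length A → ∀ a → δ (a ⊕ a) ≡ 0
  δ-self 2≤|A| a = ind-no (InD? A (a ⊕ a)) λ a⊕a∈D →
    <⇒≱ (≤-trans 2≤|A| (length≤reps𝟎 A)) (≤-reflexive (trans (cong (reps A) (sym (⊕-self a))) a⊕a∈D))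

  -- Two translated products with the same difference t sum to 2 R(t) ≤ 4.
  paired-products≤4 : ∀ {t} c d → c ⊕ d ≡ t → InD A t →
                      ∑V r (λ v → α v * α (v ⊕ t) + α (v ⊕ c) * α (v ⊕ d)) ≤ 4
  paired-products≤4 {t} c d c⊕d≡t t∈D = begin
      ∑V r (λ v → α v * α (v ⊕ t) + α (v ⊕ c) * α (v ⊕ d))
    ≡⟨ ∑-+ (allVecs r) _ _ ⟩
      R A t + ∑V r (λ v → α (v ⊕ c) * α (v ⊕ d))
    ≡⟨ cong (R A t +_) (trans (R-translate A c d) (cong (R A) c⊕d≡t)) ⟩
      R A t + R A t
    ≤⟨ +-mono-≤ (R≤2 t∈D) (R≤2 t∈D) ⟩
      4
    ∎
    where open ≤-Reasoning


  -- No D-triangle: if x, y and s = x ⊕ y lie in D(A) then 4|A| ≤ 2^r + 12.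
  -- Each v contributes the four points v, v ⊕ x, v ⊕ y, v ⊕ s, and the six
  -- pairs among them have differences x, y or s, each counted by R ≤ 2.
  no-D-triangle : ∀ {x y} → InD A x → InD A y → InD A (x ⊕ y) → 4 * length A ≤ 2 ^ r + 12
  no-D-triangle {x} {y} x∈D y∈D s∈D = begin
      4 * length A
    ≡⟨ four-copies (length A) ⟩
      length A + length A + length A + length A
    ≡⟨ sym ∑-four-points ⟩
      ∑V r (λ v → α v + α (v ⊕ x) + α (v ⊕ y) + α (v ⊕ s))
    ≤⟨ ∑-mono (allVecs r) (λ v → four-points (α≤1 v) (α≤1 _) (α≤1 _) (α≤1 _)) ⟩
      ∑V r (λ v → 1 + (Pˣ v + Pʸ v) + Pˢ v)
    ≡⟨ ∑-pairs ⟩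
      2 ^ r + (∑V r Pˣ + ∑V r Pʸ) + ∑V r Pˢ
    ≤⟨ +-mono-≤ (+-monoʳ-≤ (2 ^ r) (+-mono-≤ (paired-products≤4 y s (⊕-cancelᵐ x y) x∈D)
                                              (paired-products≤4 x s (⊕-cancelˡ x y) y∈D)))
                (paired-products≤4 x y refl s∈D) ⟩
      2 ^ r + (4 + 4) + 4
    ≡⟨ +-assoc (2 ^ r) 8 4 ⟩
      2 ^ r + 12
    ∎
    where
    open ≤-Reasoning
    s = x ⊕ y
    Vs = allVecs r
    four-copies : ∀ n → 4 * n ≡ n + n + n + n
    four-copies = solve-∀
    Pˣ Pʸ Pˢ : F2^ r → ℕ
    Pˣ v = α v * α (v ⊕ x) + α (v ⊕ y) * α (v ⊕ s)
    Pʸ v = α v * α (v ⊕ y) + α (v ⊕ x) * α (v ⊕ s)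
    Pˢ v = α v * α (v ⊕ s) + α (v ⊕ x) * α (v ⊕ y)
    ∑-four-points : ∑V r (λ v → α v + α (v ⊕ x) + α (v ⊕ y) + α (v ⊕ s))
                  ≡ length A + length A + length A + length A
    ∑-four-points =
      trans (∑-+ Vs _ _) (cong₂ _+_
        (trans (∑-+ Vs _ _) (cong₂ _+_
          (trans (∑-+ Vs _ _) (cong₂ _+_ ∑α (∑α-translate x)))
          (∑α-translate y)))
        (∑α-translate s))
    ∑-pairs : ∑V r (λ v → 1 + (Pˣ v + Pʸ v) + Pˢ v) ≡ 2 ^ r + (∑V r Pˣ + ∑V r Pʸ) + ∑V r Pˢ
    ∑-pairs = trans (∑-+ Vs _ Pˢ) (cong (_+ ∑V r Pˢ)
                (trans (∑-+ Vs (λ _ → 1) _) (cong₂ _+_ (∑V-one r) (∑-+ Vs Pˣ Pʸ))))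

  -- Unique partner: if a₁ ≠ a₂ in A have s = a₁ ⊕ a₂ ∈ D(A), then no other
  -- b has both b and b ⊕ s in A, since the three pairs (a₁, a₂), (a₂, a₁),
  -- (b, b ⊕ s) would give R(s) ≥ 3.
  unique-partner : ∀ {a₁ a₂} → a₁ ∈ A → a₂ ∈ A → ¬ a₁ ≡ a₂ → InD A (a₁ ⊕ a₂) →
                   ∀ {b} → ¬ b ≡ a₁ → ¬ b ≡ a₂ → α b * α (b ⊕ (a₁ ⊕ a₂)) ≡ 0
  unique-partner {a₁} {a₂} a₁∈A a₂∈A a₁≢a₂ s∈D {b} b≢a₁ b≢a₂ =
    n≤0⇒n≡0 (+-cancelˡ-≤ 2 (m b) 0 (begin
      2 + m b                   ≤⟨ +-monoʳ-≤ 2 (m≤m+n (m b) 0) ⟩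
      2 + (m b + 0)             ≡⟨ cong₂ (λ p q → p + (q + (m b + 0))) (sym m-a₁) (sym m-a₂) ⟩
      ∑ (a₁ ∷ a₂ ∷ b ∷ []) m    ≤⟨ ∑-unique≤∑V (a₁ ∷ a₂ ∷ b ∷ []) distinct m ⟩
      R A s                     ≤⟨ R≤2 s∈D ⟩
      2                         ∎))
    where
    open ≤-Reasoning
    s = a₁ ⊕ a₂
    m : F2^ r → ℕ
    m v = α v * α (v ⊕ s)
    distinct : Unique (a₁ ∷ a₂ ∷ b ∷ [])
    distinct = (a₁≢a₂ ∷ ≢-sym b≢a₁ ∷ []) ∷ (≢-sym b≢a₂ ∷ []) ∷ [] ∷ []
    m-a₁ : m a₁ ≡ 1
    m-a₁ = cong₂ _*_ (α-∈ a₁∈A) (trans (cong α (⊕-cancelˡ a₁ a₂)) (α-∈ a₂∈A))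
    m-a₂ : m a₂ ≡ 1
    m-a₂ = cong₂ _*_ (α-∈ a₂∈A) (trans (cong α (⊕-cancelᵐ a₁ a₂)) (α-∈ a₁∈A))
two≤length : ∀ r n → 2 ^ r + 12 < 4 * n → 2 ≤ n
two≤length r zero          large = ⊥-elim (<⇒≱ large z≤n)
two≤length r (suc zero)    large = ⊥-elim (<⇒≱ large (≤-trans (≤ᵇ⇒≤ 4 12 _) (m≤n+m 12 (2 ^ r))))
two≤length r (suc (suc n)) large = s≤s (s≤s z≤n)

module Edge {r : ℕ} (A : List (F2^ r)) (uA : Unique A) (large : 2 ^ r + 12 < 4 * length A)
            {a₁ a₂ : F2^ r} (a₁∈A : a₁ ∈ A) (a₂∈A : a₂ ∈ A)
            (a₁≢a₂ : ¬ a₁ ≡ a₂) (s∈D : InD A (a₁ ⊕ a₂)) where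

  open Indicators A uA

  s : F2^ r
  s = a₁ ⊕ a₂

  adj : F2^ r → F2^ r → ℕ
  adj a v = ind (Adj? A a v)

  adj-δ : ∀ {a v} → ¬ a ≡ v → adj a v ≡ δ (a ⊕ v)
  adj-δ {a} {v} a≢v = ind-iff (Adj? A a v) (InD? A (a ⊕ v)) proj₂ (a≢v ,_)

  F G : F2^ r → ℕ
  F v = α v + δ (a₁ ⊕ v)
  G v = α v * (adj a₁ v + adj a₂ v)

  ∑F : ∑V r F ≡ length A + length (D A)
  ∑F = trans (∑-+ (allVecs r) α _) (cong₂ _+_ ∑α (∑δ-translate a₁))

  ∑G : ∑V r G ≡ deg A a₁ + deg A a₂
  ∑G = trans (∑-cong (allVecs r) (λ v → *-distribˡ-+ (α v) (adj a₁ v) (adj a₂ v)))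
             (trans (∑-+ (allVecs r) _ _) (cong₂ _+_ (∑deg a₁) (∑deg a₂)))

  pairSum : (F2^ r → ℕ) → F2^ r → ℕ
  pairSum f v = f v + f (v ⊕ s)

  pairSum-partner : ∀ f v → pairSum f (v ⊕ s) ≡ pairSum f v
  pairSum-partner f v = trans (cong (λ w → f (v ⊕ s) + f w) (⊕-cancelʳ s v)) (+-comm (f (v ⊕ s)) (f v))

  a₁-partner : a₁ ⊕ s ≡ a₂
  a₁-partner = ⊕-cancelˡ a₁ a₂

  G-member : ∀ {v} → v ∈ A → G v ≡ adj a₁ v + adj a₂ v
  G-member {v} v∈A = trans (cong (_* (adj a₁ v + adj a₂ v)) (α-∈ v∈A)) (*-identityˡ _)

  G-a₁ : 1 ≤ G a₁
  G-a₁ = begin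
      1                      ≡⟨ sym (ind-yes (Adj? A a₂ a₁) (≢-sym a₁≢a₂ , subst (InD A) (⊕-comm a₁ a₂) s∈D)) ⟩
      adj a₂ a₁              ≤⟨ m≤n+m _ (adj a₁ a₁) ⟩
      adj a₁ a₁ + adj a₂ a₁  ≡⟨ sym (G-member a₁∈A) ⟩
      G a₁                   ∎
    where open ≤-Reasoning

  G-a₂ : 1 ≤ G a₂
  G-a₂ = begin
      1                      ≡⟨ sym (ind-yes (Adj? A a₁ a₂) (a₁≢a₂ , s∈D)) ⟩
      adj a₁ a₂              ≤⟨ m≤m+n _ (adj a₂ a₂) ⟩
      adj a₁ a₂ + adj a₂ a₂  ≡⟨ sym (G-member a₂∈A) ⟩
      G a₂                   ∎
    where open ≤-Reasoning

  -- On the coset {a₁, a₂}: F sums to at most 3 (as a₁ ⊕ a₁ ∉ D(A)), while G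
  -- is positive at both points (a₁ and a₂ are adjacent).
  pair-at-a₁ : pairSum F a₁ ≤ pairSum G a₁ + 1
  pair-at-a₁ = begin
      F a₁ + F (a₁ ⊕ s)
    ≤⟨ +-mono-≤ (+-mono-≤ (α≤1 a₁) (≤-reflexive (δ-self (two≤length r (length A) large) a₁)))
                (+-mono-≤ (α≤1 _) (ind≤1 _)) ⟩
      1 + 1 + 1
    ≤⟨ +-monoˡ-≤ 1 (+-mono-≤ G-a₁ (≤-trans G-a₂ (≤-reflexive (cong G (sym a₁-partner))))) ⟩
      G a₁ + G (a₁ ⊕ s) + 1
    ∎
    where open ≤-Reasoning

  pair-at-a₂ : pairSum F a₂ ≤ pairSum G a₂ + 1
  pair-at-a₂ = subst (λ w → pairSum F w ≤ pairSum G w + 1) a₁-partner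
    (subst₂ _≤_ (sym (pairSum-partner F a₁)) (cong (_+ 1) (sym (pairSum-partner G a₁))) pair-at-a₁)

  -- On any other coset {v, v ⊕ s}, with p = δ(a₁ ⊕ v) and q = δ(a₂ ⊕ v), we have
  -- F(v) + F(v ⊕ s) = u + (p + q) and G(v) + G(v ⊕ s) = u·(p + q) for
  -- u = α(v) + α(v ⊕ s); here u ≤ 1 by unique-partner and p + q ≤ 1 by no-D-triangle.
  pair-generic : ∀ {v} → ¬ v ≡ a₁ → ¬ v ≡ a₂ → pairSum F v ≤ pairSum G v + 1
  pair-generic {v} v≢a₁ v≢a₂ = begin
      (α v + p) + (α (v ⊕ s) + δ (a₁ ⊕ (v ⊕ s)))
    ≡⟨ cong (λ t → (α v + p) + (α (v ⊕ s) + δ t)) (⊕-shift a₁ a₂ v) ⟩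
      (α v + p) + (α (v ⊕ s) + q)
    ≡⟨ interchange (α v) p (α (v ⊕ s)) q ⟩
      (α v + α (v ⊕ s)) + (p + q)
    ≤⟨ bit-+≤*+1 partners≤1 p+q≤1 ⟩
      (α v + α (v ⊕ s)) * (p + q) + 1
    ≡⟨ cong (_+ 1) (*-distribʳ-+ (p + q) (α v) (α (v ⊕ s))) ⟩
      α v * (p + q) + α (v ⊕ s) * (p + q) + 1
    ≡⟨ cong (_+ 1) (sym (cong₂ _+_ G-v G-v⊕s)) ⟩
      G v + G (v ⊕ s) + 1
    ∎
    where
    open ≤-Reasoning
    p q : ℕ
    p = δ (a₁ ⊕ v)
    q = δ (a₂ ⊕ v)
    partners≤1 : α v + α (v ⊕ s) ≤ 1
    partners≤1 = bits-sum≤1 (α≤1 v) (α≤1 _) (unique-partner a₁∈A a₂∈A a₁≢a₂ s∈D v≢a₁ v≢a₂)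
    p+q≤1 : p + q ≤ 1
    p+q≤1 = ind-exclusive (InD? A (a₁ ⊕ v)) (InD? A (a₂ ⊕ v)) λ x∈D y∈D →
      <⇒≱ large (no-D-triangle x∈D y∈D (subst (InD A) (sym (⊕-cancel-common a₁ a₂ v)) s∈D))
    v⊕s≢a₁ : ¬ a₁ ≡ v ⊕ s
    v⊕s≢a₁ eq = v≢a₂ (trans (⊕-move a₁ v s eq) a₁-partner)
    v⊕s≢a₂ : ¬ a₂ ≡ v ⊕ s
    v⊕s≢a₂ eq = v≢a₁ (trans (⊕-move a₂ v s eq) (⊕-cancelᵐ a₁ a₂))
    G-v : G v ≡ α v * (p + q)
    G-v = cong (α v *_) (cong₂ _+_ (adj-δ (≢-sym v≢a₁)) (adj-δ (≢-sym v≢a₂)))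
    G-v⊕s : G (v ⊕ s) ≡ α (v ⊕ s) * (p + q)
    G-v⊕s = cong (α (v ⊕ s) *_) (trans
      (cong₂ _+_ (trans (adj-δ v⊕s≢a₁) (cong δ (⊕-shift a₁ a₂ v)))
                 (trans (adj-δ v⊕s≢a₂) (cong δ (trans (cong (λ t → a₂ ⊕ (v ⊕ t)) (⊕-comm a₁ a₂))
                                                     (⊕-shift a₂ a₁ v)))))
      (+-comm q p))

  pair : ∀ v → pairSum F v ≤ pairSum G v + 1
  pair v with v ≟V a₁ | v ≟V a₂
  ... | yes refl | _        = pair-at-a₁
  ... | no _     | yes refl = pair-at-a₂
  ... | no v≢a₁  | no v≢a₂  = pair-generic v≢a₁ v≢a₂

  doubled : 2 * (length A + length (D A)) ≤ 2 * (deg A a₁ + deg A a₂) + 2 ^ r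
  doubled = begin
      2 * (length A + length (D A))        ≡⟨ cong (2 *_) (sym ∑F) ⟩
      2 * ∑V r F                           ≡⟨ ∑V-doubled r F s ⟩
      ∑V r (pairSum F)                     ≤⟨ ∑-mono (allVecs r) pair ⟩
      ∑V r (λ v → pairSum G v + 1)         ≡⟨ ∑-+ (allVecs r) (pairSum G) (λ _ → 1) ⟩
      ∑V r (pairSum G) + ∑V r (λ _ → 1)    ≡⟨ cong₂ _+_ (sym (∑V-doubled r G s)) (∑V-one r) ⟩
      2 * ∑V r G + 2 ^ r                   ≡⟨ cong (λ t → 2 * t + 2 ^ r) ∑G ⟩
      2 * (deg A a₁ + deg A a₂) + 2 ^ r    ∎
    where open ≤-Reasoning

proposition3p7 : (r : ℕ) → 1 ≤ r → (A : List (F2^ r)) → Unique A →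
    2 ^ r + 12 < 4 * length A →
    (a₁ a₂ : F2^ r) → a₁ ∈ A → a₂ ∈ A → Adj A a₁ a₂ →
    length A + length (D A) ≤ deg A a₁ + deg A a₂ + 2 ^ (r ∸ 1)
proposition3p7 zero    ()
proposition3p7 (suc k) _ A uA large a₁ a₂ a₁∈A a₂∈A (a₁≢a₂ , s∈D) =
  *-cancelˡ-≤ 2 (begin
      2 * (length A + length (D A))
    ≤⟨ Edge.doubled A uA large a₁∈A a₂∈A a₁≢a₂ s∈D ⟩
      2 * (deg A a₁ + deg A a₂) + 2 * 2 ^ k
    ≡⟨ sym (*-distribˡ-+ 2 (deg A a₁ + deg A a₂) (2 ^ k)) ⟩
      2 * (deg A a₁ + deg A a₂ + 2 ^ k)
    ∎)
  where open ≤-Reasoning
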